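{- For integers $n\ge 0$ and $k\ge 0$, let $J^P_{k,n}$ denote the number of maximal configurations resistant to predators of length $n$ with exactly $k$ occupied lots (with $J^P_{0,0}=1$, counting the empty configuration of length $0$). Then, as formal power series, $$\sum_{n\ge0}\sum_{k\ge0} J^P_{k,n}\,x^k y^n=\frac{1+xy-(x-x^2)y^2-x^2y^3}{1-xy^2-x^2y^3}.$$
   Context: A configuration of length $n$ is a string $c_1c_2\cdots c_n\in\{0,1\}^n$; lot $p$ is occupied (has a house) if $c_p=1$ and empty if $c_p=0$; the occupancy is the number of $1$'s. A house at position $p$ is blocked from sunlight if $1<p<n$ and $c_{p-1}=c_{p+1}=1$ (positions $1$ and $n$ always receive sunlight from the boundary). A configuration is permissible if no house is blocked. It is maximal if it is permissible and changing any single $0$ into a $1$ yields a configuration that is not permissible. A maximal configuration is resistant to predators if for every empty lot $p$, after changing $c_p$ to $1$ the new house at $p$ is blocked. -}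

module Defs where

open import Data.Bool using (Bool; true; false; _∧_; _∨_; not; if_then_else_; T?)
open import Data.Nat using (ℕ; zero; suc; _+_; _∸_; _<ᵇ_; _≡ᵇ_)
open import Data.List using (List; []; _∷_; map; concatMap; length; filter; foldr; upTo)
open import Data.Integer using (ℤ; +_; -_) renaming (_+_ to _+ℤ_; _*_ to _*ℤ_)

-- Configurations of length n: lists of booleans of length n
-- (true = occupied lot). Positions are 0-indexed: position i here is
-- lot p = i+1 of the paper.

allB : {A : Set} → (A → Bool) → List A → Bool
allB p = foldr (λ a b → p a ∧ b) true

Config : Set
Config = List Bool

configs : ℕ → List Config
configs zero    = [] ∷ []
configs (suc n) = concatMap (λ c → (false ∷ c) ∷ (true ∷ c) ∷ []) (configs n)

at : Config → ℕ → Bool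
at []       _       = false
at (b ∷ c)  zero    = b
at (b ∷ c)  (suc i) = at c i

setAt : Config → ℕ → Config
setAt []      _       = []
setAt (b ∷ c) zero    = true ∷ c
setAt (b ∷ c) (suc i) = b ∷ setAt c i

occupancy : Config → ℕ
occupancy = foldr (λ b k → if b then suc k else k) 0

positions : Config → List ℕ
positions c = upTo (length c)

-- the house at position i is blocked: it is a house, it is not at
-- either end (0 < i < n-1), and both neighbours are houses
blocked : Config → ℕ → Bool
blocked c zero    = false
blocked c (suc j) =
  at c (suc j) ∧ (suc (suc j) <ᵇ length c) ∧ at c j ∧ at c (suc (suc j))

permissible : Config → Bool
permissible c = allB (λ i → not (blocked c i)) (positions c)

maximal : Config → Bool
maximal c = permissible c ∧
  allB (λ i → at c i ∨ not (permissible (setAt c i))) (positions c)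

resistant : Config → Bool
resistant c = maximal c ∧
  allB (λ i → at c i ∨ blocked (setAt c i) i) (positions c)

JP : ℕ → ℕ → ℕ
JP k n = length (filter (λ c → T? (resistant c ∧ (occupancy c ≡ᵇ k))) (configs n))

-- Formal power series in x, y with integer coefficients:
-- f k n is the coefficient of x^k y^n.

PS : Set
PS = ℕ → ℕ → ℤ

sumℤ : List ℤ → ℤ
sumℤ = foldr _+ℤ_ (+ 0)

_⊛_ : PS → PS → PS
(f ⊛ g) k n =
  sumℤ (concatMap (λ i → map (λ j → f i j *ℤ g (k ∸ i) (n ∸ j)) (upTo (suc n)))
                  (upTo (suc k)))

JPseries : PS
JPseries k n = + JP k n

numer : PS
numer 0 0 = + 1
numer 1 1 = + 1
numer 1 2 = - (+ 1)
numer 2 2 = + 1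
numer 2 3 = - (+ 1)
numer _ _ = + 0

denom : PS
denom 0 0 = + 1
denom 1 2 = - (+ 1)
denom 2 3 = - (+ 1)
denom _ _ = + 0

{-# OPTIONS --safe #-}
module Submission where

-- A resistant configuration is automatically maximal, and with the ground
-- beyond both ends counting as empty, being permissible and resistant says
-- exactly that a lot is occupied iff its two neighbours are not both occupied.
-- Read from the left this is an automaton whose state is the last two lots;
-- following it through the first lots shows that a resistant configuration of
-- length n ≥ 4 is 10w or 110w with w resistant and nonempty, so
-- J_{k,n} = J_{k-1,n-2} + J_{k-2,n-3}. Hence J·(1 - x y² - x² y³) has no terms
-- with n ≥ 4, and its coefficients with n ≤ 3 are those of the numerator.

open import Defs
open import Data.Integer using (ℤ; +_) renaming (_+_ to _+ℤ_; _*_ to _*ℤ_)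
import Data.Integer.Properties as ℤ
open import Algebra.Properties.AbelianGroup ℤ.+-0-abelianGroup using (∙-cancelʳ)
open import Algebra.Properties.Semiring.Sum ℤ.+-*-semiring
  using (sum-syntax; sum⁺-syntax; sum-cong-≗; sum-replicate-zero; ∑-distrib-+; ∑-permute)
open import Data.Bool using (Bool; true; false; _∧_; _∨_; not; _xor_; T; T?)
open import Data.Bool.Properties using (∧-zeroʳ; ∧-identityʳ; not-injective; ¬-not; not-¬)
open import Data.Fin using (Fin; toℕ)
open import Data.Fin.Properties using (toℕ≤pred[n]; opposite-prop)
import Data.Fin.Permutation as Permutation
open import Data.List using (List; []; _∷_; _++_; map; concatMap; length; filter; upTo; applyUpTo)
open import Data.List.Membership.Propositional using (_∈_)
open import Data.List.Membership.Propositional.Properties using (∈-upTo⁺; ∈-upTo⁻)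
open import Data.List.Properties using (map-applyUpTo; foldr-map; filter-≐)
open import Data.List.Relation.Unary.Any using (here; there)
open import Data.Nat using (ℕ; zero; suc; _+_; _∸_; _<_; _≡ᵇ_; s≤s)
open import Data.Nat.Properties using (+-identityʳ; +-suc; m∸[m∸n]≡n)
open import Data.Product using (_,_)
open import Function using (_∘_; id)
open import Relation.Binary.PropositionalEquality using (_≡_; refl; sym; trans; cong; cong₂; subst)
open Relation.Binary.PropositionalEquality.≡-Reasoning

-- Resistance as a local rule

-- l is the lot just left of c; lots past the right end are empty because at is false there
stableAt : Bool → Config → ℕ → Bool
stableAt l c i = at c i xor (at (l ∷ c) i ∧ at c (suc i))

stable : Bool → Config → Bool
stable l []      = true
stable l (m ∷ c) = (m xor (l ∧ at c 0)) ∧ stable m c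

blocked-window : ∀ c i → blocked c i ≡ at (false ∷ c) i ∧ (at c i ∧ at c (suc i))
blocked-window c                  zero          = refl
blocked-window []                 (suc i)       = refl
blocked-window (x ∷ [])           1             = sym (∧-zeroʳ x)
blocked-window (x ∷ false ∷ c)    1             = sym (∧-zeroʳ x)
blocked-window (x ∷ true ∷ [])     1             = sym (∧-zeroʳ x)
blocked-window (x ∷ true ∷ _ ∷ c) 1             = refl
blocked-window (x ∷ c)            (suc (suc i)) = blocked-window c (suc i)

blocked-setAt : ∀ c i → i < length c → blocked (setAt c i) i ≡ at (false ∷ c) i ∧ at c (suc i)
blocked-setAt c               zero          _         = refl
blocked-setAt (x ∷ [])        1             (s≤s ())
blocked-setAt (x ∷ _ ∷ [])    1             _         = sym (∧-zeroʳ x)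
blocked-setAt (x ∷ _ ∷ _ ∷ c) 1             _         = refl
blocked-setAt (x ∷ c)         (suc (suc i)) (s≤s i<n) = blocked-setAt c (suc i) i<n

length-setAt : ∀ c i → length (setAt c i) ≡ length c
length-setAt []      i       = refl
length-setAt (b ∷ c) zero    = refl
length-setAt (b ∷ c) (suc i) = cong suc (length-setAt c i)

allB-∧ : ∀ {A : Set} (p q : A → Bool) xs → allB p xs ∧ allB q xs ≡ allB (λ x → p x ∧ q x) xs
allB-∧ p q []       = refl
allB-∧ p q (x ∷ xs) with p x | q x
... | false | _     = refl
... | true  | false = ∧-zeroʳ (allB p xs)
... | true  | true  = allB-∧ p q xs

allB-cong : ∀ {A : Set} {p q : A → Bool} xs → (∀ {x} → x ∈ xs → p x ≡ q x) → allB p xs ≡ allB q xs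
allB-cong []       p≡q = refl
allB-cong (x ∷ xs) p≡q = cong₂ _∧_ (p≡q (here refl)) (allB-cong xs (p≡q ∘ there))

allB-∈ : ∀ {A : Set} {p : A → Bool} {xs x} → allB p xs ≡ true → x ∈ xs → p x ≡ true
allB-∈ {p = p} {y ∷ _} all (here refl) with p y
... | true = refl
allB-∈ {p = p} {y ∷ _} all (there x∈) with p y
... | true = allB-∈ all x∈

allB-applyUpTo-suc : ∀ (p : ℕ → Bool) n → allB p (applyUpTo suc n) ≡ allB (p ∘ suc) (upTo n)
allB-applyUpTo-suc p n = trans (cong (allB p) (sym (map-applyUpTo id suc n))) (foldr-map _ suc true (upTo n))

allB-stableAt : ∀ l c → allB (stableAt l c) (positions c) ≡ stable l c
allB-stableAt l []      = refl
allB-stableAt l (m ∷ c) =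
  cong ((m xor (l ∧ at c 0)) ∧_)
       (trans (allB-applyUpTo-suc (stableAt l (m ∷ c)) (length c)) (allB-stableAt m c))

blocked⇒impermissible : ∀ {c i} → i < length c → blocked c i ≡ true → permissible c ≡ false
blocked⇒impermissible i<n blocked-i = ¬-not λ permissible-c →
  not-¬ blocked-i (not-injective (allB-∈ permissible-c (∈-upTo⁺ i<n)))

resisting⇒maximal : ∀ {c i} → i < length c → (at c i ∨ blocked (setAt c i) i) ≡ true →
                    (at c i ∨ not (permissible (setAt c i))) ≡ true
resisting⇒maximal {c} {i} i<n resists with at c i
... | true  = refl
... | false = cong not (blocked⇒impermissible (subst (i <_) (sym (length-setAt c i)) i<n) resists)

lot-conditions≡stableAt : ∀ {c i} → i < length c →
  (not (blocked c i) ∧ (at c i ∨ not (permissible (setAt c i)))) ∧ (at c i ∨ blocked (setAt c i) i)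
  ≡ stableAt false c i
lot-conditions≡stableAt {c} {i} i<n = begin
  (not (blocked c i) ∧ (at c i ∨ not (permissible (setAt c i)))) ∧ (at c i ∨ blocked (setAt c i) i)
    ≡⟨ ∧-absorb (not (blocked c i)) _ (resisting⇒maximal i<n) ⟩
  not (blocked c i) ∧ (at c i ∨ blocked (setAt c i) i)
    ≡⟨ cong₂ (λ b b′ → not b ∧ (at c i ∨ b′)) (blocked-window c i) (blocked-setAt c i i<n) ⟩
  not (at (false ∷ c) i ∧ (at c i ∧ at c (suc i))) ∧ (at c i ∨ (at (false ∷ c) i ∧ at c (suc i)))
    ≡⟨ unblocked∧resisting (at (false ∷ c) i) (at c i) (at c (suc i)) ⟩
  stableAt false c i ∎
  where
  ∧-absorb : ∀ a {b} r → (r ≡ true → b ≡ true) → (a ∧ b) ∧ r ≡ a ∧ r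
  ∧-absorb false r     _   = refl
  ∧-absorb true  false _   = ∧-zeroʳ _
  ∧-absorb true  true  r⇒b = cong (_∧ true) (r⇒b refl)

  unblocked∧resisting : ∀ l m r → not (l ∧ (m ∧ r)) ∧ (m ∨ (l ∧ r)) ≡ m xor (l ∧ r)
  unblocked∧resisting l     true  r = ∧-identityʳ (not (l ∧ r))
  unblocked∧resisting false false r = refl
  unblocked∧resisting true  false r = refl

resistant≡stable : ∀ c → resistant c ≡ stable false c
resistant≡stable c = begin
  resistant c
    ≡⟨ cong (_∧ allB resists (positions c)) (allB-∧ unblocked maximalAt (positions c)) ⟩
  allB (λ i → unblocked i ∧ maximalAt i) (positions c) ∧ allB resists (positions c)
    ≡⟨ allB-∧ (λ i → unblocked i ∧ maximalAt i) resists (positions c) ⟩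
  allB (λ i → (unblocked i ∧ maximalAt i) ∧ resists i) (positions c)
    ≡⟨ allB-cong (positions c) (lot-conditions≡stableAt ∘ ∈-upTo⁻) ⟩
  allB (stableAt false c) (positions c)
    ≡⟨ allB-stableAt false c ⟩
  stable false c ∎
  where
  unblocked maximalAt resists : ℕ → Bool
  unblocked i = not (blocked c i)
  maximalAt i = at c i ∨ not (permissible (setAt c i))
  resists   i = at c i ∨ blocked (setAt c i) i

-- Counting configurations by their first lots

count : (Config → Bool) → List Config → ℕ
count P = length ∘ filter (T? ∘ P)

count-extend : ∀ P L →
  count P (concatMap (λ c → (false ∷ c) ∷ (true ∷ c) ∷ []) L) ≡
  count (P ∘ (false ∷_)) L + count (P ∘ (true ∷_)) L
count-extend P []      = refl
count-extend P (c ∷ L) with P (false ∷ c)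
... | false with P (true ∷ c)
...   | false = count-extend P L
...   | true  = trans (cong suc (count-extend P L)) (sym (+-suc _ _))
count-extend P (c ∷ L) | true with P (true ∷ c)
...   | false = cong suc (count-extend P L)
...   | true  = cong suc (trans (cong suc (count-extend P L)) (sym (+-suc _ _)))

count-cong : ∀ {P Q} → (∀ c → P c ≡ Q c) → ∀ L → count P L ≡ count Q L
count-cong {P} {Q} P≡Q L = cong length (filter-≐ (T? ∘ P) (T? ∘ Q)
  ((λ {c} → subst T (P≡Q c)) , (λ {c} → subst T (sym (P≡Q c)))) L)

count-false : ∀ L → count (λ _ → false) L ≡ 0
count-false []      = refl
count-false (_ ∷ L) = count-false L

withHouses : (Config → Bool) → ℕ → ℕ → ℕ
withHouses P k n = count (λ c → P c ∧ (occupancy c ≡ᵇ k)) (configs n)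

withHouses-suc-suc : ∀ P k n →
  withHouses P (suc k) (suc n) ≡ withHouses (P ∘ (false ∷_)) (suc k) n + withHouses (P ∘ (true ∷_)) k n
withHouses-suc-suc P k n = count-extend _ (configs n)

withHouses-suc-zero : ∀ P n → withHouses P 0 (suc n) ≡ withHouses (P ∘ (false ∷_)) 0 n
withHouses-suc-zero P n = begin
  withHouses P 0 (suc n)
    ≡⟨ count-extend _ (configs n) ⟩
  withHouses (P ∘ (false ∷_)) 0 n + count (λ c → P (true ∷ c) ∧ false) (configs n)
    ≡⟨ cong (_+_ (withHouses (P ∘ (false ∷_)) 0 n))
            (trans (count-cong (∧-zeroʳ ∘ P ∘ (true ∷_)) (configs n)) (count-false (configs n))) ⟩
  withHouses (P ∘ (false ∷_)) 0 n + 0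
    ≡⟨ +-identityʳ _ ⟩
  withHouses (P ∘ (false ∷_)) 0 n ∎

withHouses-nothing : ∀ k n → withHouses (λ _ → false) k n ≡ 0
withHouses-nothing k n = count-false (configs n)

withHouses-cong-∷ : ∀ {P Q} → (∀ b c → P (b ∷ c) ≡ Q (b ∷ c)) →
                    ∀ k n → withHouses P k (suc n) ≡ withHouses Q k (suc n)
withHouses-cong-∷ P≡Q k n = trans (count-extend _ (configs n)) (trans
  (cong₂ _+_ (count-cong (λ c → cong (_∧ (occupancy (false ∷ c) ≡ᵇ k)) (P≡Q false c)) (configs n))
             (count-cong (λ c → cong (_∧ (occupancy (true ∷ c) ≡ᵇ k)) (P≡Q true c)) (configs n)))
  (sym (count-extend _ (configs n))))

afterSingleHouse afterTwoHouses afterGap : Config → Bool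
afterSingleHouse c = stable false (true ∷ c)
afterTwoHouses   c = stable true (true ∷ c)
afterGap         c = stable true (false ∷ c)

JP≡withHouses-stable : ∀ k n → JP k n ≡ withHouses (stable false) k n
JP≡withHouses-stable k n = count-cong (λ c → cong (_∧ (occupancy c ≡ᵇ k)) (resistant≡stable c)) (configs n)

JP-no-houses : ∀ n → JP 0 (suc n) ≡ 0
JP-no-houses n =
  trans (JP≡withHouses-stable 0 (suc n)) (trans (withHouses-suc-zero (stable false) n) (withHouses-nothing 0 n))

JP-suc : ∀ k n → JP (suc k) (suc n) ≡ withHouses afterSingleHouse k n
JP-suc k n = begin
  JP (suc k) (suc n)
    ≡⟨ JP≡withHouses-stable (suc k) (suc n) ⟩
  withHouses (stable false) (suc k) (suc n)
    ≡⟨ withHouses-suc-suc (stable false) k n ⟩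
  withHouses (λ _ → false) (suc k) n + withHouses afterSingleHouse k n
    ≡⟨ cong (_+ withHouses afterSingleHouse k n) (withHouses-nothing (suc k) n) ⟩
  withHouses afterSingleHouse k n ∎

withHouses-afterGap : ∀ k n → withHouses afterGap k (suc n) ≡ JP k (suc n)
withHouses-afterGap k n =
  trans (withHouses-cong-∷ (λ { false c → refl ; true c → refl }) k n) (sym (JP≡withHouses-stable k (suc n)))

withHouses-afterTwoHouses : ∀ k n → withHouses afterTwoHouses k (suc n) ≡ withHouses afterGap k n
withHouses-afterTwoHouses zero    n = withHouses-suc-zero afterTwoHouses n
withHouses-afterTwoHouses (suc k) n = begin
  withHouses afterTwoHouses (suc k) (suc n)
    ≡⟨ withHouses-suc-suc afterTwoHouses k n ⟩
  withHouses afterGap (suc k) n + withHouses (λ _ → false) k n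
    ≡⟨ cong (_+_ (withHouses afterGap (suc k) n)) (withHouses-nothing k n) ⟩
  withHouses afterGap (suc k) n + 0
    ≡⟨ +-identityʳ _ ⟩
  withHouses afterGap (suc k) n ∎

-- Multiplication by the denominator

sumℤ-++ : ∀ xs ys → sumℤ (xs ++ ys) ≡ sumℤ xs +ℤ sumℤ ys
sumℤ-++ []       ys = sym (ℤ.+-identityˡ (sumℤ ys))
sumℤ-++ (x ∷ xs) ys = trans (cong (x +ℤ_) (sumℤ-++ xs ys)) (sym (ℤ.+-assoc x (sumℤ xs) (sumℤ ys)))

sumℤ-concatMap : ∀ {A : Set} (F : A → List ℤ) xs → sumℤ (concatMap F xs) ≡ sumℤ (map (sumℤ ∘ F) xs)
sumℤ-concatMap F []       = refl
sumℤ-concatMap F (x ∷ xs) = trans (sumℤ-++ (F x) _) (cong (sumℤ (F x) +ℤ_) (sumℤ-concatMap F xs))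

sumℤ-applyUpTo : ∀ (h : ℕ → ℤ) m → sumℤ (applyUpTo h m) ≡ ∑[ i < m ] h (toℕ i)
sumℤ-applyUpTo h zero    = refl
sumℤ-applyUpTo h (suc m) = cong (h 0 +ℤ_) (sumℤ-applyUpTo (h ∘ suc) m)

sumℤ-map-upTo : ∀ (h : ℕ → ℤ) m → sumℤ (map h (upTo m)) ≡ ∑[ i < m ] h (toℕ i)
sumℤ-map-upTo h m = trans (cong sumℤ (map-applyUpTo id h m)) (sumℤ-applyUpTo h m)

∑-reverse : ∀ n (h : ℕ → ℤ) → ∑[ i ≤ n ] h (toℕ i) ≡ ∑[ i ≤ n ] h (n ∸ toℕ i)
∑-reverse n h = trans (∑-permute (h ∘ toℕ) Permutation.reverse) (sum-cong-≗ (cong h ∘ opposite-prop))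

convolution : PS → PS → PS
convolution f g k n = ∑[ i ≤ k ] ∑[ j ≤ n ] (f (toℕ i) (toℕ j) *ℤ g (k ∸ toℕ i) (n ∸ toℕ j))

⊛≡convolution : ∀ f g k n → (f ⊛ g) k n ≡ convolution f g k n
⊛≡convolution f g k n = begin
  (f ⊛ g) k n
    ≡⟨ sumℤ-concatMap (λ i → map (term i) (upTo (suc n))) (upTo (suc k)) ⟩
  sumℤ (map (λ i → sumℤ (map (term i) (upTo (suc n)))) (upTo (suc k)))
    ≡⟨ sumℤ-map-upTo (λ i → sumℤ (map (term i) (upTo (suc n)))) (suc k) ⟩
  ∑[ i ≤ k ] sumℤ (map (term (toℕ i)) (upTo (suc n)))
    ≡⟨ sum-cong-≗ {suc k} (λ i → sumℤ-map-upTo (term (toℕ i)) (suc n)) ⟩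
  convolution f g k n ∎
  where
  term : ℕ → ℕ → ℤ
  term i j = f i j *ℤ g (k ∸ i) (n ∸ j)

⊛-comm : ∀ f g k n → (f ⊛ g) k n ≡ (g ⊛ f) k n
⊛-comm f g k n = begin
  (f ⊛ g) k n
    ≡⟨ ⊛≡convolution f g k n ⟩
  ∑[ i ≤ k ] ∑[ j ≤ n ] (f (toℕ i) (toℕ j) *ℤ g (k ∸ toℕ i) (n ∸ toℕ j))
    ≡⟨ ∑-reverse k (λ x → ∑[ j ≤ n ] (f x (toℕ j) *ℤ g (k ∸ x) (n ∸ toℕ j))) ⟩
  ∑[ i ≤ k ] ∑[ j ≤ n ] (f (k ∸ toℕ i) (toℕ j) *ℤ g (k ∸ (k ∸ toℕ i)) (n ∸ toℕ j))
    ≡⟨ sum-cong-≗ {suc k} (λ i → ∑-reverse n (λ y → f (k ∸ toℕ i) y *ℤ g (k ∸ (k ∸ toℕ i)) (n ∸ y))) ⟩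
  ∑[ i ≤ k ] ∑[ j ≤ n ] (f (k ∸ toℕ i) (n ∸ toℕ j) *ℤ g (k ∸ (k ∸ toℕ i)) (n ∸ (n ∸ toℕ j)))
    ≡⟨ sum-cong-≗ {suc k} (λ i → sum-cong-≗ {suc n} (unreverse i)) ⟩
  convolution g f k n
    ≡⟨ ⊛≡convolution g f k n ⟨
  (g ⊛ f) k n ∎
  where
  unreverse : ∀ (i : Fin (suc k)) (j : Fin (suc n)) →
    f (k ∸ toℕ i) (n ∸ toℕ j) *ℤ g (k ∸ (k ∸ toℕ i)) (n ∸ (n ∸ toℕ j)) ≡
    g (toℕ i) (toℕ j) *ℤ f (k ∸ toℕ i) (n ∸ toℕ j)
  unreverse i j rewrite m∸[m∸n]≡n (toℕ≤pred[n] i) | m∸[m∸n]≡n (toℕ≤pred[n] j) =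
    ℤ.*-comm (f (k ∸ toℕ i) (n ∸ toℕ j)) (g (toℕ i) (toℕ j))

⊛-distribʳ-+ : ∀ {e g h : PS} f → (∀ i j → e i j ≡ g i j +ℤ h i j) →
               ∀ k n → (e ⊛ f) k n ≡ (g ⊛ f) k n +ℤ (h ⊛ f) k n
⊛-distribʳ-+ {e} {g} {h} f e≡g+h k n = begin
  (e ⊛ f) k n
    ≡⟨ ⊛≡convolution e f k n ⟩
  ∑[ i ≤ k ] ∑[ j ≤ n ] term e (toℕ i) (toℕ j)
    ≡⟨ sum-cong-≗ {suc k} (λ i → sum-cong-≗ {suc n} (λ j → term-distrib (toℕ i) (toℕ j))) ⟩
  ∑[ i ≤ k ] ∑[ j ≤ n ] (term g (toℕ i) (toℕ j) +ℤ term h (toℕ i) (toℕ j))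
    ≡⟨ sum-cong-≗ {suc k} (λ i → ∑-distrib-+ {suc n} (term g (toℕ i) ∘ toℕ) (term h (toℕ i) ∘ toℕ)) ⟩
  ∑[ i ≤ k ] (∑[ j ≤ n ] term g (toℕ i) (toℕ j) +ℤ ∑[ j ≤ n ] term h (toℕ i) (toℕ j))
    ≡⟨ ∑-distrib-+ {suc k} (λ i → ∑[ j ≤ n ] term g (toℕ i) (toℕ j))
                           (λ i → ∑[ j ≤ n ] term h (toℕ i) (toℕ j)) ⟩
  convolution g f k n +ℤ convolution h f k n
    ≡⟨ cong₂ _+ℤ_ (⊛≡convolution g f k n) (⊛≡convolution h f k n) ⟨
  (g ⊛ f) k n +ℤ (h ⊛ f) k n ∎
  where
  term : PS → ℕ → ℕ → ℤ
  term a i j = a i j *ℤ f (k ∸ i) (n ∸ j)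

  term-distrib : ∀ i j → term e i j ≡ term g i j +ℤ term h i j
  term-distrib i j =
    trans (cong (_*ℤ f (k ∸ i) (n ∸ j)) (e≡g+h i j)) (ℤ.*-distribʳ-+ (f (k ∸ i) (n ∸ j)) (g i j) (h i j))

one : PS
one zero zero = + 1
one _    _    = + 0

-- shift a b f = x^a y^b f
shift : ℕ → ℕ → PS → PS
shift zero    zero    f k       n       = f k n
shift zero    (suc b) f k       zero    = + 0
shift zero    (suc b) f k       (suc n) = shift zero b f k n
shift (suc a) b       f zero    n       = + 0
shift (suc a) b       f (suc k) n       = shift a b f k n

convolution-one : ∀ f k n → convolution one f k n ≡ f k n
convolution-one f k n = begin
  (+ 1 *ℤ f k n +ℤ ∑[ j < n ] (+ 0)) +ℤ ∑[ i < k ] ∑[ j ≤ n ] (+ 0)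
    ≡⟨ cong₂ _+ℤ_ (cong₂ _+ℤ_ (ℤ.*-identityˡ (f k n)) (sum-replicate-zero n))
                  (trans (sum-cong-≗ {k} (λ _ → sum-replicate-zero (suc n))) (sum-replicate-zero k)) ⟩
  (f k n +ℤ + 0) +ℤ + 0
    ≡⟨ trans (ℤ.+-identityʳ _) (ℤ.+-identityʳ (f k n)) ⟩
  f k n ∎

convolution-shift-one : ∀ a b f k n → convolution (shift a b one) f k n ≡ shift a b f k n
convolution-shift-one zero    zero    f k n       = convolution-one f k n
convolution-shift-one zero    (suc b) f k zero    = sum-replicate-zero (suc k)
convolution-shift-one zero    (suc b) f k (suc n) =
  trans (sum-cong-≗ {suc k} (λ i → ℤ.+-identityˡ (row i))) (convolution-shift-one zero b f k n)
  where
  row : Fin (suc k) → ℤ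
  row i = ∑[ j ≤ n ] (shift zero b one (toℕ i) (toℕ j) *ℤ f (k ∸ toℕ i) (n ∸ toℕ j))
convolution-shift-one (suc a) b       f zero    n = cong (_+ℤ + 0) (sum-replicate-zero (suc n))
convolution-shift-one (suc a) b       f (suc k) n = begin
  ∑[ j ≤ n ] (+ 0) +ℤ convolution (shift a b one) f k n
    ≡⟨ cong (_+ℤ convolution (shift a b one) f k n) (sum-replicate-zero (suc n)) ⟩
  + 0 +ℤ convolution (shift a b one) f k n
    ≡⟨ ℤ.+-identityˡ _ ⟩
  convolution (shift a b one) f k n
    ≡⟨ convolution-shift-one a b f k n ⟩
  shift a b f k n ∎

monomial-⊛ : ∀ a b f k n → (shift a b one ⊛ f) k n ≡ shift a b f k n
monomial-⊛ a b f k n = trans (⊛≡convolution (shift a b one) f k n) (convolution-shift-one a b f k n)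

one≡denom+xy²+x²y³ : ∀ i j → one i j ≡ denom i j +ℤ (shift 1 2 one i j +ℤ shift 2 3 one i j)
one≡denom+xy²+x²y³ 0 0                                     = refl
one≡denom+xy²+x²y³ 0 (suc j)                               = refl
one≡denom+xy²+x²y³ 1 0                                     = refl
one≡denom+xy²+x²y³ 1 1                                     = refl
one≡denom+xy²+x²y³ 1 2                                     = refl
one≡denom+xy²+x²y³ 1 (suc (suc (suc j)))                   = refl
one≡denom+xy²+x²y³ 2 0                                     = refl
one≡denom+xy²+x²y³ 2 1                                     = refl
one≡denom+xy²+x²y³ 2 2                                     = refl
one≡denom+xy²+x²y³ 2 3                                     = refl
one≡denom+xy²+x²y³ 2 (suc (suc (suc (suc j))))             = refl
one≡denom+xy²+x²y³ (suc (suc (suc i))) 0                   = refl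
one≡denom+xy²+x²y³ (suc (suc (suc i))) 1                   = refl
one≡denom+xy²+x²y³ (suc (suc (suc i))) 2                   = refl
one≡denom+xy²+x²y³ (suc (suc (suc i))) (suc (suc (suc j))) = refl

⊛-denom : ∀ f k n → (f ⊛ denom) k n +ℤ (shift 1 2 f k n +ℤ shift 2 3 f k n) ≡ f k n
⊛-denom f k n = begin
  (f ⊛ denom) k n +ℤ (shift 1 2 f k n +ℤ shift 2 3 f k n)
    ≡⟨ cong₂ _+ℤ_ (⊛-comm f denom k n) (sym (cong₂ _+ℤ_ (monomial-⊛ 1 2 f k n) (monomial-⊛ 2 3 f k n))) ⟩
  (denom ⊛ f) k n +ℤ ((shift 1 2 one ⊛ f) k n +ℤ (shift 2 3 one ⊛ f) k n)
    ≡⟨ cong ((denom ⊛ f) k n +ℤ_)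
            (⊛-distribʳ-+ {g = shift 1 2 one} {h = shift 2 3 one} f (λ _ _ → refl) k n) ⟨
  (denom ⊛ f) k n +ℤ ((λ i j → shift 1 2 one i j +ℤ shift 2 3 one i j) ⊛ f) k n
    ≡⟨ ⊛-distribʳ-+ {g = denom} f one≡denom+xy²+x²y³ k n ⟨
  (one ⊛ f) k n
    ≡⟨ monomial-⊛ 0 0 f k n ⟩
  f k n ∎

-- The coefficients of the generating function

JPseries-recurrence : ∀ k n →
  JPseries k (4 + n) ≡ shift 1 2 JPseries k (4 + n) +ℤ shift 2 3 JPseries k (4 + n)
JPseries-recurrence 0             n = cong +_ (JP-no-houses (3 + n))
JPseries-recurrence 1             n = cong +_ (begin
  JP 1 (4 + n)                          ≡⟨ JP-suc 0 (3 + n) ⟩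
  withHouses afterSingleHouse 0 (3 + n) ≡⟨ withHouses-suc-zero afterSingleHouse (2 + n) ⟩
  withHouses afterGap 0 (2 + n)         ≡⟨ withHouses-afterGap 0 (1 + n) ⟩
  JP 0 (2 + n)                          ≡⟨ +-identityʳ _ ⟨
  JP 0 (2 + n) + 0                      ∎)
JPseries-recurrence (suc (suc k)) n = cong +_ (begin
  JP (2 + k) (4 + n)
    ≡⟨ JP-suc (suc k) (3 + n) ⟩
  withHouses afterSingleHouse (1 + k) (3 + n)
    ≡⟨ withHouses-suc-suc afterSingleHouse k (2 + n) ⟩
  withHouses afterGap (1 + k) (2 + n) + withHouses afterTwoHouses k (2 + n)
    ≡⟨ cong₂ _+_ (withHouses-afterGap (suc k) (1 + n)) (withHouses-afterTwoHouses k (1 + n)) ⟩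
  JP (1 + k) (2 + n) + withHouses afterGap k (1 + n)
    ≡⟨ cong (_+_ (JP (1 + k) (2 + n))) (withHouses-afterGap k n) ⟩
  JP (1 + k) (2 + n) + JP k (1 + n) ∎)

numer-vanishes : ∀ k n → numer k (4 + n) ≡ + 0
numer-vanishes 0                   n = refl
numer-vanishes 1                   n = refl
numer-vanishes 2                   n = refl
numer-vanishes (suc (suc (suc k))) n = refl

JPseries≡numer+xy²JP+x²y³JP : ∀ k n →
  JPseries k n ≡ numer k n +ℤ (shift 1 2 JPseries k n +ℤ shift 2 3 JPseries k n)
JPseries≡numer+xy²JP+x²y³JP 0                   0 = refl
JPseries≡numer+xy²JP+x²y³JP 1                   0 = refl
JPseries≡numer+xy²JP+x²y³JP 2                   0 = refl
JPseries≡numer+xy²JP+x²y³JP (suc (suc (suc k))) 0 = refl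
JPseries≡numer+xy²JP+x²y³JP 0                   1 = refl
JPseries≡numer+xy²JP+x²y³JP 1                   1 = refl
JPseries≡numer+xy²JP+x²y³JP 2                   1 = refl
JPseries≡numer+xy²JP+x²y³JP (suc (suc (suc k))) 1 = refl
JPseries≡numer+xy²JP+x²y³JP 0                   2 = refl
JPseries≡numer+xy²JP+x²y³JP 1                   2 = refl
JPseries≡numer+xy²JP+x²y³JP 2                   2 = refl
JPseries≡numer+xy²JP+x²y³JP (suc (suc (suc k))) 2 = refl
JPseries≡numer+xy²JP+x²y³JP 0                   3 = refl
JPseries≡numer+xy²JP+x²y³JP 1                   3 = refl
JPseries≡numer+xy²JP+x²y³JP 2                   3 = refl
JPseries≡numer+xy²JP+x²y³JP (suc (suc (suc k))) 3 = refl
JPseries≡numer+xy²JP+x²y³JP k (suc (suc (suc (suc n)))) = begin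
  JPseries k (4 + n)        ≡⟨ JPseries-recurrence k n ⟩
  shifts                    ≡⟨ ℤ.+-identityˡ shifts ⟨
  + 0 +ℤ shifts             ≡⟨ cong (_+ℤ shifts) (numer-vanishes k n) ⟨
  numer k (4 + n) +ℤ shifts ∎
  where
  shifts : ℤ
  shifts = shift 1 2 JPseries k (4 + n) +ℤ shift 2 3 JPseries k (4 + n)

mainTheorem1 : ∀ (k n : ℕ) → (JPseries ⊛ denom) k n ≡ numer k n
mainTheorem1 k n = ∙-cancelʳ shifts ((JPseries ⊛ denom) k n) (numer k n) (begin
  (JPseries ⊛ denom) k n +ℤ shifts ≡⟨ ⊛-denom JPseries k n ⟩
  JPseries k n                     ≡⟨ JPseries≡numer+xy²JP+x²y³JP k n ⟩
  numer k n +ℤ shifts              ∎)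
  where
  shifts : ℤ
  shifts = shift 1 2 JPseries k n +ℤ shift 2 3 JPseries k n
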